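{- Let $n\ge 1$ and $m\ge 2$. Let $\operatorname{Dist}(D_n,m)$ be the polytope of tuples $p=(p_{\tau_1},\dots,p_{\tau_n})$ of $m\times m$ real matrices with nonnegative entries $p_{\tau_i}^{ab}$ ($a,b\in\{0,\dots,m-1\}$), each with total sum $1$, such that all matrices $p_{\tau_i}$ have the same vector of row sums and the same vector of column sums. Then the assignment $$p\longmapsto (A_1,\dots,A_n),\qquad A_i=\{(e_a,e_b)^T:\ p_{\tau_i}^{ab}\neq 0\},$$ is a one-to-one correspondence between the vertices of $\operatorname{Dist}(D_n,m)$ and the collections $A_1,\dots,A_n$ of sets of product-simplex vertices in $\mathbb{R}^{2m}$ satisfying: (1) for every $1\le i\le n$, the set $A_i$ is affinely independent; (2) the intersection $\bigcap_{i=1}^n\operatorname{Conv}(A_i)$ consists of a single point $u$, and for every $1\le i\le n$ the unique affine representation $u=\sum_{x\in A_i}\alpha_x x$ has $\alpha_x\neq 0$ for all $x\in A_i$.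
   Context: $D_n$ is the dipole graph: two nodes $s,t$ and $n$ directed edges $\tau_1,\dots,\tau_n$, each from $s$ to $t$. A distribution on it with outcomes in $\{0,\dots,m-1\}$ assigns to each edge a probability matrix $p_{\tau_i}$ such that the row sums of $p_{\tau_i}$ give a common probability vector at $s$ and the column sums give a common probability vector at $t$; this is the polytope $\operatorname{Dist}(D_n,m)$ described in the claim. $e_0,\dots,e_{m-1}$ are the standard basis vectors of $\mathbb{R}^m$; a product-simplex vertex in $\mathbb{R}^{2m}$ is a vector $(e_a,e_b)^T\in\mathbb{R}^{2m}$ obtained by stacking $e_a$ on top of $e_b$. $\operatorname{Conv}$ denotes convex hull.
   Formalization: The matrices $p_{\tau_i}$ have rational entries, and the points of $\mathbb{R}^{2m}$ and all affine and convex coefficients are taken over ℚ rather than the reals. -}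

module Defs where

open import Data.Nat using (ℕ; zero; suc)
open import Data.Fin using (Fin; zero; suc)
open import Data.Bool using (Bool; true; false; not)
open import Data.Sum using (_⊎_; inj₁; inj₂)
open import Data.Product using (_×_; Σ; ∃; _,_)
open import Data.Rational using (ℚ; 0ℚ; 1ℚ; _+_; _*_; _-_; _≤_; _<_)
open import Data.Rational.Properties using (_≟_)
open import Relation.Binary.PropositionalEquality using (_≡_)
open import Relation.Nullary using (¬_; does)
open import Data.Fin.Properties renaming (_≟_ to _≟ᶠ_) using ()

∑ : ∀ {k : ℕ} → (Fin k → ℚ) → ℚ
∑ {zero}  f = 0ℚ
∑ {suc k} f = f zero + ∑ (λ j → f (suc j))

Mat : ℕ → Set
Mat m = Fin m → Fin m → ℚ

Tuple : ℕ → ℕ → Set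
Tuple n m = Fin n → Mat m

rowSum : ∀ {m} → Mat m → Fin m → ℚ
rowSum M a = ∑ (λ b → M a b)

colSum : ∀ {m} → Mat m → Fin m → ℚ
colSum M b = ∑ (λ a → M a b)

total : ∀ {m} → Mat m → ℚ
total M = ∑ (λ a → ∑ (λ b → M a b))

InDist : (n m : ℕ) → Tuple n m → Set
InDist n m p =
  (∀ i a b → 0ℚ ≤ p i a b) ×
  (∀ i → total (p i) ≡ 1ℚ) ×
  (∀ i j a → rowSum (p i) a ≡ rowSum (p j) a) ×
  (∀ i j b → colSum (p i) b ≡ colSum (p j) b)

_≈ᵀ_ : ∀ {n m} → Tuple n m → Tuple n m → Set
p ≈ᵀ q = ∀ i a b → p i a b ≡ q i a b

mix : ∀ {n m} → ℚ → Tuple n m → Tuple n m → Tuple n m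
mix t q r i a b = t * q i a b + (1ℚ - t) * r i a b

IsVertex : (n m : ℕ) → Tuple n m → Set
IsVertex n m p =
  InDist n m p ×
  (∀ q r t → InDist n m q → InDist n m r → 0ℚ < t → t < 1ℚ →
     p ≈ᵀ mix t q r → q ≈ᵀ r)

-- The space ℝ^{2m} (here ℚ^{2m}), coordinates split as top block ⊎ bottom block.
R2m : ℕ → Set
R2m m = Fin m ⊎ Fin m → ℚ

δ : ∀ {m} → Fin m → Fin m → ℚ
δ a c with does (a ≟ᶠ c)
... | true  = 1ℚ
... | false = 0ℚ

psv : ∀ {m} → Fin m → Fin m → R2m m
psv a b (inj₁ c) = δ a c
psv a b (inj₂ c) = δ b c

-- A set of product-simplex vertices: A a b = true iff (e_a,e_b)^T ∈ A.
-- ((a,b) ↦ (e_a,e_b)^T is injective, so such sets are exactly subsets of Fin m × Fin m.)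
PSVSet : ℕ → Set
PSVSet m = Fin m → Fin m → Bool

Coeffs : ℕ → Set
Coeffs m = Fin m → Fin m → ℚ

SupportedOn : ∀ {m} → Coeffs m → PSVSet m → Set
SupportedOn α A = ∀ a b → ¬ (α a b ≡ 0ℚ) → A a b ≡ true

coeffSum : ∀ {m} → Coeffs m → ℚ
coeffSum α = ∑ (λ a → ∑ (λ b → α a b))

combo : ∀ {m} → Coeffs m → R2m m
combo α c = ∑ (λ a → ∑ (λ b → α a b * psv a b c))

_≈ᴿ_ : ∀ {m} → R2m m → R2m m → Set
u ≈ᴿ v = ∀ c → u c ≡ v c

AffinelyIndependent : ∀ {m} → PSVSet m → Set
AffinelyIndependent {m} A =
  ∀ (λ' : Coeffs m) → SupportedOn λ' A → coeffSum λ' ≡ 0ℚ →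
    combo λ' ≈ᴿ (λ _ → 0ℚ) → ∀ a b → λ' a b ≡ 0ℚ

AffineRep : ∀ {m} → PSVSet m → R2m m → Coeffs m → Set
AffineRep A u α = SupportedOn α A × coeffSum α ≡ 1ℚ × combo α ≈ᴿ u

InConv : ∀ {m} → PSVSet m → R2m m → Set
InConv {m} A u = Σ (Coeffs m) λ α → (∀ a b → 0ℚ ≤ α a b) × AffineRep A u α

Admissible : (n m : ℕ) → (Fin n → PSVSet m) → Set
Admissible n m A =
  (∀ i → AffinelyIndependent (A i)) ×
  Σ (R2m m) λ u →
    (∀ i → InConv (A i) u) ×
    (∀ v → (∀ i → InConv (A i) v) → v ≈ᴿ u) ×
    (∀ i (α : Coeffs m) → AffineRep (A i) u α →
       ∀ a b → A i a b ≡ true → ¬ (α a b ≡ 0ℚ))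

support : ∀ {n m} → Tuple n m → Fin n → PSVSet m
support p i a b = not (does (p i a b ≟ 0ℚ))

_≈ˢ_ : ∀ {n m} → (Fin n → PSVSet m) → (Fin n → PSVSet m) → Set
A ≈ˢ B = ∀ i a b → A i a b ≡ B i a b

-- Σ_{a,b} α_{ab} (e_a, e_b)^T is the pair of marginals (row sums, column sums) of α, so
-- u ∈ Conv(A_i) says that u is the marginal pair of a distribution supported in A_i.
-- The key fact is that p ∈ Dist(D_n, m) is a vertex iff no other point of Dist(D_n, m) has
-- its supports inside those of p: such a q would let p move by ±ε(q − p), and conversely
-- the summands of a convex decomposition of p are supported inside p.  For a vertex p,
-- a balanced perturbation concentrated on τ_i must vanish (affine independence of A_i),
-- the representatives of any v ∈ ⋂ Conv(A_i) form such a q (uniqueness of u), and affine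
-- representations over an affinely independent set are unique (nonzero coefficients).
-- Conversely, for admissible A the representatives of u form a point with supports A
-- that these same facts make rigid, hence a vertex.

module Submission where

open import Defs
open import Data.Nat as ℕ using (ℕ; zero; suc)
open import Data.Fin using (Fin; zero; suc)
open import Data.Fin.Properties using () renaming (_≟_ to _≟ᶠ_)
open import Data.Bool using (true; false)
open import Data.Sum using (inj₁; inj₂; [_,_]′)
open import Data.Product using (_×_; Σ; _,_; proj₁; proj₂)
open import Data.Rational
  using ( ℚ; 0ℚ; 1ℚ; ½; _<?_; _+_; _*_; _-_; -_; _≤_; _<_; ∣_∣; _⊓_; 1/_
        ; Positive; NonZero; positive; nonNegative; ≢-nonZero)
open import Data.Rational.Properties
open import Data.Rational.Solver using (module +-*-Solver)
open import Algebra.Bundles using (CommutativeRing)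
open import Algebra.Properties.Semiring.Sum (CommutativeRing.semiring +-*-commutativeRing)
  using (sum; sum-cong-≗; *-distribˡ-sum; *-distribʳ-sum) renaming (∑-distrib-+ to sum-distrib-+)
open import Algebra.Properties.Ring +-*-ring using (-1*x≈-x)
open import Algebra.Properties.Group +-0-group using (x∙y⁻¹≈ε⇒x≈y)
open import Relation.Nullary using (¬_; yes; no; contradiction)
open import Relation.Nullary.Decidable using (from-yes)
open import Relation.Binary.PropositionalEquality

∑≡sum : ∀ {k} (f : Fin k → ℚ) → ∑ f ≡ sum f
∑≡sum {zero}  f = refl
∑≡sum {suc k} f = cong (f zero +_) (∑≡sum (λ j → f (suc j)))

∑-cong : ∀ {k} {f g : Fin k → ℚ} → (∀ j → f j ≡ g j) → ∑ f ≡ ∑ g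
∑-cong {f = f} {g} f≗g = trans (∑≡sum f) (trans (sum-cong-≗ f≗g) (sym (∑≡sum g)))

∑-distrib-+ : ∀ {k} (f g : Fin k → ℚ) → ∑ (λ j → f j + g j) ≡ ∑ f + ∑ g
∑-distrib-+ f g =
  trans (∑≡sum (λ j → f j + g j)) (trans (sum-distrib-+ f g) (sym (cong₂ _+_ (∑≡sum f) (∑≡sum g))))

*-distribˡ-∑ : ∀ {k} s (f : Fin k → ℚ) → s * ∑ f ≡ ∑ (λ j → s * f j)
*-distribˡ-∑ s f =
  trans (cong (s *_) (∑≡sum f)) (trans (*-distribˡ-sum s f) (sym (∑≡sum (λ j → s * f j))))

*-distribʳ-∑ : ∀ {k} s (f : Fin k → ℚ) → ∑ f * s ≡ ∑ (λ j → f j * s)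
*-distribʳ-∑ s f =
  trans (cong (_* s) (∑≡sum f)) (trans (*-distribʳ-sum s f) (sym (∑≡sum (λ j → f j * s))))

∑-neg : ∀ {k} (f : Fin k → ℚ) → ∑ (λ j → - f j) ≡ - ∑ f
∑-neg f = begin
  ∑ (λ j → - f j)       ≡⟨ ∑-cong (λ j → sym (-1*x≈-x (f j))) ⟩
  ∑ (λ j → - 1ℚ * f j)  ≡⟨ *-distribˡ-∑ (- 1ℚ) f ⟨
  - 1ℚ * ∑ f            ≡⟨ -1*x≈-x (∑ f) ⟩
  - ∑ f                 ∎
  where open ≡-Reasoning

∑-distrib-- : ∀ {k} (f g : Fin k → ℚ) → ∑ (λ j → f j - g j) ≡ ∑ f - ∑ g
∑-distrib-- f g = trans (∑-distrib-+ f (λ j → - g j)) (cong (∑ f +_) (∑-neg g))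

δ-refl : ∀ {k} (j : Fin k) → δ j j ≡ 1ℚ
δ-refl j with j ≟ᶠ j
... | yes _  = refl
... | no j≢j = contradiction refl j≢j

∑-δ : ∀ {k} (f : Fin k → ℚ) c → ∑ (λ a → f a * δ a c) ≡ f c
∑-δ {suc k} f zero = begin
  f zero * 1ℚ + ∑ (λ j → f (suc j) * 0ℚ)  ≡⟨ cong₂ _+_ (*-identityʳ (f zero)) (sym (*-distribʳ-∑ 0ℚ fₛ)) ⟩
  f zero + ∑ fₛ * 0ℚ                       ≡⟨ cong (f zero +_) (*-zeroʳ (∑ fₛ)) ⟩
  f zero + 0ℚ                              ≡⟨ +-identityʳ (f zero) ⟩
  f zero                                   ∎
  where
    open ≡-Reasoning
    fₛ = λ j → f (suc j)
∑-δ {suc k} f (suc c) =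
  trans (cong₂ _+_ (*-zeroʳ (f zero)) (∑-δ (λ j → f (suc j)) c)) (+-identityˡ (f (suc c)))

∣z∣≤x⇒0≤x+z : ∀ {x z} → ∣ z ∣ ≤ x → 0ℚ ≤ x + z
∣z∣≤x⇒0≤x+z {x} {z} ∣z∣≤x with ∣p∣≡p∨∣p∣≡-p z
... | inj₁ ∣z∣≡z  = +-mono-≤ (≤-trans (0≤∣p∣ z) ∣z∣≤x) (∣p∣≡p⇒0≤p ∣z∣≡z)
... | inj₂ ∣z∣≡-z = subst (_≤ x + z) (+-inverseˡ z) (+-monoˡ-≤ z (subst (_≤ x) ∣z∣≡-z ∣z∣≤x))

x+y≡0⇒x≡0 : ∀ {x y} → 0ℚ ≤ x → 0ℚ ≤ y → x + y ≡ 0ℚ → x ≡ 0ℚ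
x+y≡0⇒x≡0 {x} {y} x≥0 y≥0 x+y≡0 =
  ≤-antisym (subst₂ _≤_ (+-identityʳ x) x+y≡0 (+-monoʳ-≤ x y≥0)) x≥0

pos*x≡0⇒x≡0 : ∀ r .{{_ : Positive r}} {x} → r * x ≡ 0ℚ → x ≡ 0ℚ
pos*x≡0⇒x≡0 r rx≡0 = ≤-antisym
  (*-cancelˡ-≤-pos r (≤-reflexive (trans rx≡0 (sym (*-zeroʳ r)))))
  (*-cancelˡ-≤-pos r (≤-reflexive (trans (*-zeroʳ r) (sym rx≡0))))

Eventually⁺ : (ℚ → Set) → Set
Eventually⁺ G = Σ ℚ λ ε → 0ℚ < ε × (∀ e → 0ℚ < e → e ≤ ε → G e)

eventually⁺-× : ∀ {G H} → Eventually⁺ G → Eventually⁺ H → Eventually⁺ (λ e → G e × H e)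
eventually⁺-× (ε₁ , ε₁>0 , G<ε₁) (ε₂ , ε₂>0 , H<ε₂) = ε₁ ⊓ ε₂ , ε>0 , λ e e>0 e≤ε →
  G<ε₁ e e>0 (≤-trans e≤ε (p⊓q≤p ε₁ ε₂)) , H<ε₂ e e>0 (≤-trans e≤ε (p⊓q≤q ε₁ ε₂))
  where
    ε>0 : 0ℚ < ε₁ ⊓ ε₂
    ε>0 = [ (λ ≡ε₁ → subst (0ℚ <_) (sym ≡ε₁) ε₁>0) , (λ ≡ε₂ → subst (0ℚ <_) (sym ≡ε₂) ε₂>0) ]′
            (⊓-sel ε₁ ε₂)

eventually⁺-∀ : ∀ {k} {G : Fin k → ℚ → Set} → (∀ j → Eventually⁺ (G j)) → Eventually⁺ (λ e → ∀ j → G j e)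
eventually⁺-∀ {zero}  _ = 1ℚ , positive⁻¹ 1ℚ , λ _ _ _ ()
eventually⁺-∀ {suc k} {G} ev with eventually⁺-× (ev zero) (eventually⁺-∀ (λ j → ev (suc j)))
... | ε , ε>0 , G<ε = ε , ε>0 , λ e e>0 e≤ε → cons (G<ε e e>0 e≤ε)
  where
    cons : ∀ {e} → G zero e × (∀ j → G (suc j) e) → ∀ j → G j e
    cons (G₀ , _)  zero    = G₀
    cons (_ , Gₛ)  (suc j) = Gₛ j

eventually⁺-bound : ∀ {x y} → 0ℚ ≤ x → (x ≡ 0ℚ → y ≡ 0ℚ) → Eventually⁺ (λ e → e * ∣ y ∣ ≤ x)
eventually⁺-bound {x} {y} x≥0 x≡0⇒y≡0 with x ≟ 0ℚ
... | yes refl rewrite x≡0⇒y≡0 refl = 1ℚ , positive⁻¹ 1ℚ , λ e _ _ → ≤-reflexive (*-zeroʳ e)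
... | no x≢0 = ε , positive⁻¹ ε , bound
  where
    instance
      _ : Positive x
      _ = nonNeg∧nonZero⇒pos x {{nonNegative x≥0}} {{≢-nonZero x≢0}}
      _ : Positive (1ℚ + ∣ y ∣)
      _ = pos+nonNeg⇒pos 1ℚ ∣ y ∣ {{∣-∣-nonNeg y}}
      _ : NonZero (1ℚ + ∣ y ∣)
      _ = pos⇒nonZero (1ℚ + ∣ y ∣)
      _ : Positive (1/ (1ℚ + ∣ y ∣))
      _ = 1/pos⇒pos (1ℚ + ∣ y ∣)
    ε : ℚ
    ε = x * 1/ (1ℚ + ∣ y ∣)
    instance
      _ : Positive ε
      _ = pos*pos⇒pos x (1/ (1ℚ + ∣ y ∣))
    ε*[1+∣y∣]≡x : ε * (1ℚ + ∣ y ∣) ≡ x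
    ε*[1+∣y∣]≡x = trans (*-assoc x _ _) (trans (cong (x *_) (*-inverseˡ (1ℚ + ∣ y ∣))) (*-identityʳ x))
    ∣y∣≤1+∣y∣ : ∣ y ∣ ≤ 1ℚ + ∣ y ∣
    ∣y∣≤1+∣y∣ = subst (_≤ 1ℚ + ∣ y ∣) (+-identityˡ ∣ y ∣) (+-monoˡ-≤ ∣ y ∣ (<⇒≤ (positive⁻¹ 1ℚ)))
    bound : ∀ e → 0ℚ < e → e ≤ ε → e * ∣ y ∣ ≤ x
    bound e _ e≤ε = begin
      e * ∣ y ∣              ≤⟨ *-monoʳ-≤-nonNeg ∣ y ∣ {{∣-∣-nonNeg y}} e≤ε ⟩
      ε * ∣ y ∣              ≤⟨ *-monoˡ-≤-nonNeg ε {{pos⇒nonNeg ε}} ∣y∣≤1+∣y∣ ⟩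
      ε * (1ℚ + ∣ y ∣)       ≡⟨ ε*[1+∣y∣]≡x ⟩
      x                      ∎
      where open ≤-Reasoning

_+ᴹ_ : ∀ {m} → Mat m → Mat m → Mat m
(M +ᴹ N) a b = M a b + N a b

_-ᴹ_ : ∀ {m} → Mat m → Mat m → Mat m
(M -ᴹ N) a b = M a b - N a b

_·ᴹ_ : ∀ {m} → ℚ → Mat m → Mat m
(s ·ᴹ M) a b = s * M a b

infixl 6 _+ᴹ_ _-ᴹ_
infixl 7 _·ᴹ_

marginals : ∀ {m} → Mat m → R2m m
marginals M (inj₁ a) = rowSum M a
marginals M (inj₂ b) = colSum M b

combo≈marginals : ∀ {m} (α : Coeffs m) → combo α ≈ᴿ marginals α
combo≈marginals α (inj₁ c) = begin
  ∑ (λ a → ∑ (λ b → α a b * δ a c))  ≡⟨ ∑-cong (λ a → *-distribʳ-∑ (δ a c) (α a)) ⟨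
  ∑ (λ a → rowSum α a * δ a c)       ≡⟨ ∑-δ (rowSum α) c ⟩
  rowSum α c                         ∎
  where open ≡-Reasoning
combo≈marginals α (inj₂ c) = ∑-cong (λ a → ∑-δ (α a) c)

marginals-cong : ∀ {m} {M N : Mat m} → (∀ a b → M a b ≡ N a b) → marginals M ≈ᴿ marginals N
marginals-cong M≈N (inj₁ a) = ∑-cong (M≈N a)
marginals-cong M≈N (inj₂ b) = ∑-cong (λ a → M≈N a b)

total-+ᴹ : ∀ {m} (M N : Mat m) → total (M +ᴹ N) ≡ total M + total N
total-+ᴹ M N = trans (∑-cong (λ a → ∑-distrib-+ (M a) (N a))) (∑-distrib-+ (rowSum M) (rowSum N))

total--ᴹ : ∀ {m} (M N : Mat m) → total (M -ᴹ N) ≡ total M - total N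
total--ᴹ M N = trans (∑-cong (λ a → ∑-distrib-- (M a) (N a))) (∑-distrib-- (rowSum M) (rowSum N))

total-·ᴹ : ∀ {m} s (M : Mat m) → total (s ·ᴹ M) ≡ s * total M
total-·ᴹ s M = sym (trans (*-distribˡ-∑ s (rowSum M)) (∑-cong (λ a → *-distribˡ-∑ s (M a))))

marginals-+ᴹ : ∀ {m} (M N : Mat m) c → marginals (M +ᴹ N) c ≡ marginals M c + marginals N c
marginals-+ᴹ M N (inj₁ a) = ∑-distrib-+ (M a) (N a)
marginals-+ᴹ M N (inj₂ b) = ∑-distrib-+ (λ a → M a b) (λ a → N a b)

marginals--ᴹ : ∀ {m} (M N : Mat m) c → marginals (M -ᴹ N) c ≡ marginals M c - marginals N c
marginals--ᴹ M N (inj₁ a) = ∑-distrib-- (M a) (N a)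
marginals--ᴹ M N (inj₂ b) = ∑-distrib-- (λ a → M a b) (λ a → N a b)

marginals-·ᴹ : ∀ {m} s (M : Mat m) c → marginals (s ·ᴹ M) c ≡ s * marginals M c
marginals-·ᴹ s M (inj₁ a) = sym (*-distribˡ-∑ s (M a))
marginals-·ᴹ s M (inj₂ b) = sym (*-distribˡ-∑ s (λ a → M a b))

_≪_ : ∀ {m} → Mat m → Mat m → Set
M ≪ N = ∀ a b → N a b ≡ 0ℚ → M a b ≡ 0ℚ

∈support⇒≢0 : ∀ {n m} (p : Tuple n m) i a b → support p i a b ≡ true → p i a b ≢ 0ℚ
∈support⇒≢0 p i a b ∈supp with p i a b ≟ 0ℚ
... | no p≢0 = p≢0

≢0⇒∈support : ∀ {n m} (p : Tuple n m) i a b → p i a b ≢ 0ℚ → support p i a b ≡ true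
≢0⇒∈support p i a b p≢0 with p i a b ≟ 0ℚ
... | yes p≡0 = contradiction p≡0 p≢0
... | no _    = refl

≪⇒supportedOn-support : ∀ {n m} {M : Mat m} (p : Tuple n m) i → M ≪ p i → SupportedOn M (support p i)
≪⇒supportedOn-support p i M≪p a b M≢0 = ≢0⇒∈support p i a b (λ p≡0 → M≢0 (M≪p a b p≡0))

supportedOn-support⇒≪ : ∀ {n m} {M : Mat m} (p : Tuple n m) i → SupportedOn M (support p i) → M ≪ p i
supportedOn-support⇒≪ {M = M} p i M⊆supp a b p≡0 with M a b ≟ 0ℚ
... | yes M≡0 = M≡0
... | no M≢0  = contradiction p≡0 (∈support⇒≢0 p i a b (M⊆supp a b M≢0))

supportedOn-≪ : ∀ {m} {M N : Mat m} {A : PSVSet m} → M ≪ N → SupportedOn N A → SupportedOn M A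
supportedOn-≪ {N = N} M≪N N⊆A a b M≢0 with N a b ≟ 0ℚ
... | yes N≡0 = contradiction (M≪N a b N≡0) M≢0
... | no N≢0  = N⊆A a b N≢0

supportedOn--ᴹ : ∀ {m} {α β : Coeffs m} {A : PSVSet m} →
  SupportedOn α A → SupportedOn β A → SupportedOn (α -ᴹ β) A
supportedOn--ᴹ {α = α} α⊆A β⊆A a b α-β≢0 with α a b ≟ 0ℚ
... | no α≢0  = α⊆A a b α≢0
... | yes α≡0 = β⊆A a b (λ β≡0 → α-β≢0 (cong₂ _-_ α≡0 β≡0))

support-≡ : ∀ {n m} (p : Tuple n m) i {A : PSVSet m} → SupportedOn (p i) A →
  (∀ a b → A a b ≡ true → p i a b ≢ 0ℚ) → ∀ a b → support p i a b ≡ A a b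
support-≡ p i {A} p⊆A A⇒p≢0 a b with p i a b ≟ 0ℚ
... | no p≢0 = sym (p⊆A a b p≢0)
... | yes p≡0 with A a b in ab∈A
...   | true  = contradiction p≡0 (A⇒p≢0 a b ab∈A)
...   | false = refl

affineRep-resp-≈ᴿ : ∀ {m} {A : PSVSet m} {u v α} → u ≈ᴿ v → AffineRep A u α → AffineRep A v α
affineRep-resp-≈ᴿ u≈v (α⊆A , Σα≡1 , α↦u) = α⊆A , Σα≡1 , λ c → trans (α↦u c) (u≈v c)

affineRep-unique : ∀ {m} {A : PSVSet m} {u α β} → AffinelyIndependent A →
  AffineRep A u α → AffineRep A u β → ∀ a b → α a b ≡ β a b
affineRep-unique {u = u} {α} {β} independent (α⊆A , Σα≡1 , α↦u) (β⊆A , Σβ≡1 , β↦u) a b =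
  x∙y⁻¹≈ε⇒x≈y (α a b) (β a b) (independent (α -ᴹ β) (supportedOn--ᴹ α⊆A β⊆A) Σα-β≡0 α-β↦0 a b)
  where
    open ≡-Reasoning
    Σα-β≡0 : coeffSum (α -ᴹ β) ≡ 0ℚ
    Σα-β≡0 = trans (total--ᴹ α β) (cong₂ _-_ Σα≡1 Σβ≡1)
    α-β↦0 : combo (α -ᴹ β) ≈ᴿ (λ _ → 0ℚ)
    α-β↦0 c = begin
      combo (α -ᴹ β) c                ≡⟨ combo≈marginals (α -ᴹ β) c ⟩
      marginals (α -ᴹ β) c            ≡⟨ marginals--ᴹ α β c ⟩
      marginals α c - marginals β c   ≡⟨ cong₂ _-_ (combo≈marginals α c) (combo≈marginals β c) ⟨
      combo α c - combo β c           ≡⟨ cong₂ _-_ (α↦u c) (β↦u c) ⟩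
      u c - u c                       ≡⟨ +-inverseʳ (u c) ⟩
      0ℚ                              ∎

inConv-marginals : ∀ {m} {A : PSVSet m} {v} → (conv : InConv A v) → marginals (proj₁ conv) ≈ᴿ v
inConv-marginals (α , _ , _ , _ , α↦v) c = trans (sym (combo≈marginals α c)) (α↦v c)

inConv⇒affineRep : ∀ {m} {A : PSVSet m} {v} → (conv : InConv A v) → AffineRep A v (proj₁ conv)
inConv⇒affineRep (_ , _ , α-rep) = α-rep

SameMarginals : ∀ {n m} → Tuple n m → Set
SameMarginals p = ∀ i j → marginals (p i) ≈ᴿ marginals (p j)

Balanced : ∀ {n m} → Tuple n m → Set
Balanced d = (∀ i → total (d i) ≡ 0ℚ) × SameMarginals d

inDist⇒sameMarginals : ∀ {n m} {p : Tuple n m} → InDist n m p → SameMarginals p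
inDist⇒sameMarginals (_ , _ , rows , _) i j (inj₁ a) = rows i j a
inDist⇒sameMarginals (_ , _ , _ , cols) i j (inj₂ b) = cols i j b

mkInDist : ∀ {n m} {p : Tuple n m} → (∀ i a b → 0ℚ ≤ p i a b) → (∀ i → total (p i) ≡ 1ℚ) →
  SameMarginals p → InDist n m p
mkInDist nonneg totals same =
  nonneg , totals , (λ i j a → same i j (inj₁ a)) , (λ i j b → same i j (inj₂ b))

balanced--ᴹ : ∀ {n m} {p q : Tuple n m} → InDist n m q → InDist n m p → Balanced (λ i → q i -ᴹ p i)
balanced--ᴹ {p = p} {q} q∈@(_ , q-totals , _) p∈@(_ , p-totals , _) = totals , same
  where
    totals : ∀ i → total (q i -ᴹ p i) ≡ 0ℚ
    totals i = trans (total--ᴹ (q i) (p i)) (cong₂ _-_ (q-totals i) (p-totals i))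
    same : SameMarginals (λ i → q i -ᴹ p i)
    same i j c = trans (marginals--ᴹ (q i) (p i) c) (trans
      (cong₂ _-_ (inDist⇒sameMarginals q∈ i j c) (inDist⇒sameMarginals p∈ i j c))
      (sym (marginals--ᴹ (q j) (p j) c)))

perturb-inDist : ∀ {n m} {p d : Tuple n m} s → InDist n m p → Balanced d →
  (∀ i a b → ∣ s ∣ * ∣ d i a b ∣ ≤ p i a b) → InDist n m (λ i → p i +ᴹ s ·ᴹ d i)
perturb-inDist {p = p} {d} s p∈@(_ , p-totals , _) (d-totals , d-same) bound =
  mkInDist nonneg totals same
  where
    open ≡-Reasoning
    nonneg : ∀ i a b → 0ℚ ≤ p i a b + s * d i a b
    nonneg i a b = ∣z∣≤x⇒0≤x+z (subst (_≤ p i a b) (sym (∣p*q∣≡∣p∣*∣q∣ s (d i a b))) (bound i a b))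
    totals : ∀ i → total (p i +ᴹ s ·ᴹ d i) ≡ 1ℚ
    totals i = begin
      total (p i +ᴹ s ·ᴹ d i)         ≡⟨ total-+ᴹ (p i) (s ·ᴹ d i) ⟩
      total (p i) + total (s ·ᴹ d i)  ≡⟨ cong (total (p i) +_) (total-·ᴹ s (d i)) ⟩
      total (p i) + s * total (d i)   ≡⟨ cong₂ (λ x y → x + s * y) (p-totals i) (d-totals i) ⟩
      1ℚ + s * 0ℚ                     ≡⟨ cong (1ℚ +_) (*-zeroʳ s) ⟩
      1ℚ                              ∎
    marginals-perturb : ∀ i c → marginals (p i +ᴹ s ·ᴹ d i) c ≡ marginals (p i) c + s * marginals (d i) c
    marginals-perturb i c =
      trans (marginals-+ᴹ (p i) (s ·ᴹ d i) c) (cong (marginals (p i) c +_) (marginals-·ᴹ s (d i) c))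
    same : SameMarginals (λ i → p i +ᴹ s ·ᴹ d i)
    same i j c = trans (marginals-perturb i c) (trans
      (cong₂ (λ x y → x + s * y) (inDist⇒sameMarginals p∈ i j c) (d-same i j c))
      (sym (marginals-perturb j c)))

perturbation-bound : ∀ {n m} {p d : Tuple n m} → (∀ i a b → 0ℚ ≤ p i a b) → (∀ i → d i ≪ p i) →
  Σ ℚ λ ε → 0ℚ < ε × (∀ i a b → ε * ∣ d i a b ∣ ≤ p i a b)
perturbation-bound nonneg d≪p
  with eventually⁺-∀ (λ i → eventually⁺-∀ (λ a → eventually⁺-∀ (λ b →
         eventually⁺-bound (nonneg i a b) (d≪p i a b))))
... | ε , ε>0 , bound = ε , ε>0 , bound ε ε>0 ≤-refl

vertex⇒no-feasible-direction : ∀ {n m} {p d : Tuple n m} → IsVertex n m p →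
  (∀ i → d i ≪ p i) → Balanced d → ∀ i a b → d i a b ≡ 0ℚ
vertex⇒no-feasible-direction {n} {m} {p} {d} (p∈@(nonneg , _) , extreme) d≪p balanced i a b
  with perturbation-bound nonneg d≪p
... | ε , ε>0 , bound = pos*x≡0⇒x≡0 (ε + ε) {{pos+pos⇒pos ε ε}} (begin
    (ε + ε) * y                   ≡⟨ solve 3 (λ x ε y → (ε :+ ε) :* y := (x :+ ε :* y) :- (x :+ (:- ε) :* y))
                                              refl x ε y ⟩
    (x + ε * y) - (x + - ε * y)   ≡⟨ cong (_- (x + - ε * y)) (p₊≈p₋ i a b) ⟩
    (x + - ε * y) - (x + - ε * y) ≡⟨ +-inverseʳ (x + - ε * y) ⟩
    0ℚ                            ∎)
  where
    open ≡-Reasoning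
    open +-*-Solver
    instance
      _ : Positive ε
      _ = positive ε>0
    x = p i a b
    y = d i a b
    p₊ p₋ : Tuple n m
    p₊ j = p j +ᴹ ε ·ᴹ d j
    p₋ j = p j +ᴹ (- ε) ·ᴹ d j
    ∣ε∣≡ε : ∣ ε ∣ ≡ ε
    ∣ε∣≡ε = 0≤p⇒∣p∣≡p (<⇒≤ ε>0)
    p₊∈ : InDist n m p₊
    p₊∈ = perturb-inDist ε p∈ balanced
      (λ j a b → subst (λ e → e * ∣ d j a b ∣ ≤ p j a b) (sym ∣ε∣≡ε) (bound j a b))
    p₋∈ : InDist n m p₋
    p₋∈ = perturb-inDist (- ε) p∈ balanced
      (λ j a b → subst (λ e → e * ∣ d j a b ∣ ≤ p j a b) (sym (trans (∣-p∣≡∣p∣ ε) ∣ε∣≡ε)) (bound j a b))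
    p≈midpoint : p ≈ᵀ mix ½ p₊ p₋
    p≈midpoint j a b =
      solve 3 (λ x ε y → x := con ½ :* (x :+ ε :* y) :+ (con 1ℚ :- con ½) :* (x :+ (:- ε) :* y))
        refl (p j a b) ε (d j a b)
    p₊≈p₋ : p₊ ≈ᵀ p₋
    p₊≈p₋ = extreme p₊ p₋ ½ p₊∈ p₋∈ (positive⁻¹ ½) (from-yes (½ <? 1ℚ)) p≈midpoint

SupportRigid : (n m : ℕ) → Tuple n m → Set
SupportRigid n m p = ∀ q → InDist n m q → (∀ i → q i ≪ p i) → q ≈ᵀ p

vertex⇒supportRigid : ∀ {n m} {p : Tuple n m} → IsVertex n m p → SupportRigid n m p
vertex⇒supportRigid {p = p} V@(p∈ , _) q q∈ q≪p i a b =
  x∙y⁻¹≈ε⇒x≈y (q i a b) (p i a b) (vertex⇒no-feasible-direction V q-p≪p (balanced--ᴹ q∈ p∈) i a b)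
  where
    q-p≪p : ∀ i → (q i -ᴹ p i) ≪ p i
    q-p≪p i a b p≡0 = cong₂ _-_ (q≪p i a b p≡0) p≡0

supportRigid⇒vertex : ∀ {n m} {p : Tuple n m} → InDist n m p → SupportRigid n m p → IsVertex n m p
supportRigid⇒vertex {p = p} p∈ rigid = p∈ , extreme
  where
    extreme : ∀ q r t → InDist _ _ q → InDist _ _ r → 0ℚ < t → t < 1ℚ → p ≈ᵀ mix t q r → q ≈ᵀ r
    extreme q r t q∈@(q≥0 , _) r∈@(r≥0 , _) t>0 t<1 p≈mix i a b =
      trans (rigid q q∈ q≪p i a b) (sym (rigid r r∈ r≪p i a b))
      where
        instance
          _ : Positive t
          _ = positive t>0
          _ : Positive (1ℚ - t)
          _ = positive (subst (_< 1ℚ - t) (+-inverseʳ t) (+-monoˡ-< (- t) t<1))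
        pos*nonNeg≥0 : ∀ s .{{_ : Positive s}} {x} → 0ℚ ≤ x → 0ℚ ≤ s * x
        pos*nonNeg≥0 s {x} x≥0 = subst (_≤ s * x) (*-zeroʳ s) (*-monoˡ-≤-nonNeg s {{pos⇒nonNeg s}} x≥0)
        tq≥0 : ∀ i a b → 0ℚ ≤ t * q i a b
        tq≥0 i a b = pos*nonNeg≥0 t (q≥0 i a b)
        [1-t]r≥0 : ∀ i a b → 0ℚ ≤ (1ℚ - t) * r i a b
        [1-t]r≥0 i a b = pos*nonNeg≥0 (1ℚ - t) (r≥0 i a b)
        q≪p : ∀ i → q i ≪ p i
        q≪p i a b p≡0 = pos*x≡0⇒x≡0 t (x+y≡0⇒x≡0 (tq≥0 i a b) ([1-t]r≥0 i a b)
          (trans (sym (p≈mix i a b)) p≡0))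
        r≪p : ∀ i → r i ≪ p i
        r≪p i a b p≡0 = pos*x≡0⇒x≡0 (1ℚ - t) (x+y≡0⇒x≡0 ([1-t]r≥0 i a b) (tq≥0 i a b)
          (trans (+-comm _ (t * q i a b)) (trans (sym (p≈mix i a b)) p≡0)))

concentrated : ∀ {n m} → Fin n → Mat m → Tuple n m
concentrated i M j = δ j i ·ᴹ M

concentrated-≪ : ∀ {n m} {p : Tuple n m} {M : Mat m} i → M ≪ p i → ∀ j → concentrated i M j ≪ p j
concentrated-≪ {M = M} i M≪p j a b p≡0 with j ≟ᶠ i
... | yes refl = trans (*-identityˡ (M a b)) (M≪p a b p≡0)
... | no _     = *-zeroˡ (M a b)

concentrated-balanced : ∀ {n m} {M : Mat m} (i : Fin n) → total M ≡ 0ℚ → marginals M ≈ᴿ (λ _ → 0ℚ) →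
  Balanced (concentrated i M)
concentrated-balanced {M = M} i ΣM≡0 margM≡0 = totals , λ j k c → trans (margins j c) (sym (margins k c))
  where
    totals : ∀ j → total (concentrated i M j) ≡ 0ℚ
    totals j = trans (total-·ᴹ (δ j i) M) (trans (cong (δ j i *_) ΣM≡0) (*-zeroʳ (δ j i)))
    margins : ∀ j c → marginals (concentrated i M j) c ≡ 0ℚ
    margins j c =
      trans (marginals-·ᴹ (δ j i) M c) (trans (cong (δ j i *_) (margM≡0 c)) (*-zeroʳ (δ j i)))

vertex⇒affinelyIndependent : ∀ {n m} {p : Tuple n m} → IsVertex n m p →
  ∀ i → AffinelyIndependent (support p i)
vertex⇒affinelyIndependent {p = p} V i λ′ λ′⊆supp Σλ′≡0 λ′↦0 a b = begin
  λ′ a b          ≡⟨ *-identityˡ (λ′ a b) ⟨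
  1ℚ * λ′ a b     ≡⟨ cong (_* λ′ a b) (δ-refl i) ⟨
  δ i i * λ′ a b  ≡⟨ vertex⇒no-feasible-direction V
                       (concentrated-≪ i (supportedOn-support⇒≪ p i λ′⊆supp))
                       (concentrated-balanced i Σλ′≡0 λ′-marginals≡0) i a b ⟩
  0ℚ              ∎
  where
    open ≡-Reasoning
    λ′-marginals≡0 : marginals λ′ ≈ᴿ (λ _ → 0ℚ)
    λ′-marginals≡0 c = trans (sym (combo≈marginals λ′ c)) (λ′↦0 c)

representatives : ∀ {n m} {A : Fin n → PSVSet m} {v} → (∀ i → InConv (A i) v) → Tuple n m
representatives conv i = proj₁ (conv i)

representatives-inDist : ∀ {n m} {A : Fin n → PSVSet m} {v} (conv : ∀ i → InConv (A i) v) →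
  InDist n m (representatives conv)
representatives-inDist conv =
  mkInDist (λ i → proj₁ (proj₂ (conv i))) (λ i → proj₁ (proj₂ (inConv⇒affineRep (conv i))))
    (λ i j c → trans (inConv-marginals (conv i) c) (sym (inConv-marginals (conv j) c)))

inDist⇒inConv : ∀ {n m} {q : Tuple n m} {A : Fin n → PSVSet m} → InDist n m q →
  (∀ i → SupportedOn (q i) (A i)) → ∀ i j → InConv (A i) (marginals (q j))
inDist⇒inConv {q = q} q∈@(q≥0 , q-totals , _) q⊆A i j =
  q i , q≥0 i , q⊆A i , q-totals i ,
  λ c → trans (combo≈marginals (q i) c) (inDist⇒sameMarginals q∈ i j c)

vertex⇒admissible : ∀ {n m} {p : Tuple n m} → Fin n → IsVertex n m p → Admissible n m (support p)
vertex⇒admissible {m = m} {p} i₀ V@(p∈ , _) = independent , marginals (p i₀) , conv , unique , nonzero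
  where
    independent : ∀ i → AffinelyIndependent (support p i)
    independent = vertex⇒affinelyIndependent V
    conv : ∀ i → InConv (support p i) (marginals (p i₀))
    conv i = inDist⇒inConv p∈ (λ i → ≪⇒supportedOn-support p i (λ _ _ p≡0 → p≡0)) i i₀
    unique : ∀ v → (∀ i → InConv (support p i) v) → v ≈ᴿ marginals (p i₀)
    unique v convᵥ c = trans (sym (inConv-marginals (convᵥ i₀) c)) (marginals-cong (q≈p i₀) c)
      where
        q≪p : ∀ i → representatives convᵥ i ≪ p i
        q≪p i = supportedOn-support⇒≪ p i (proj₁ (inConv⇒affineRep (convᵥ i)))
        q≈p : representatives convᵥ ≈ᵀ p
        q≈p = vertex⇒supportRigid V (representatives convᵥ) (representatives-inDist convᵥ) q≪p
    nonzero : ∀ i (α : Coeffs m) → AffineRep (support p i) (marginals (p i₀)) α →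
      ∀ a b → support p i a b ≡ true → ¬ α a b ≡ 0ℚ
    nonzero i α α-rep a b ab∈supp α≡0 = ∈support⇒≢0 p i a b ab∈supp
      (trans (sym (affineRep-unique (independent i) α-rep (inConv⇒affineRep (conv i)) a b)) α≡0)

vertex-determined-by-support : ∀ {n m} {p q : Tuple n m} → IsVertex n m p → IsVertex n m q →
  support p ≈ˢ support q → p ≈ᵀ q
vertex-determined-by-support {p = p} {q} V (q∈ , _) supp≈ i a b =
  sym (vertex⇒supportRigid V q q∈ q≪p i a b)
  where
    q≪p : ∀ i → q i ≪ p i
    q≪p i = supportedOn-support⇒≪ p i (λ a b q≢0 → trans (supp≈ i a b) (≢0⇒∈support q i a b q≢0))

admissible⇒vertex : ∀ {n m} {A : Fin n → PSVSet m} → Fin n → Admissible n m A →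
  Σ (Tuple n m) λ p → IsVertex n m p × support p ≈ˢ A
admissible⇒vertex {n} {m} {A} i₀ (independent , u , conv , unique , nonzero) =
  p , supportRigid⇒vertex (representatives-inDist conv) rigid , support≈A
  where
    p : Tuple n m
    p = representatives conv
    p-rep : ∀ i → AffineRep (A i) u (p i)
    p-rep i = inConv⇒affineRep (conv i)
    support≈A : support p ≈ˢ A
    support≈A i = support-≡ p i (proj₁ (p-rep i)) (λ a b ab∈A → nonzero i (p i) (p-rep i) a b ab∈A)
    rigid : SupportRigid n m p
    rigid q q∈ q≪p i =
      affineRep-unique (independent i) (affineRep-resp-≈ᴿ q₀≈u (inConv⇒affineRep (convq i i₀))) (p-rep i)
      where
        convq : ∀ i j → InConv (A i) (marginals (q j))
        convq = inDist⇒inConv q∈ (λ i → supportedOn-≪ (q≪p i) (proj₁ (p-rep i)))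
        q₀≈u : marginals (q i₀) ≈ᴿ u
        q₀≈u = unique (marginals (q i₀)) (λ i → convq i i₀)

theorem4p23 : (n m : ℕ) → 1 ℕ.≤ n → 2 ℕ.≤ m →
    ((p : Tuple n m) → IsVertex n m p → Admissible n m (support p)) ×
    ((p q : Tuple n m) → IsVertex n m p → IsVertex n m q →
       support p ≈ˢ support q → p ≈ᵀ q) ×
    ((A : Fin n → PSVSet m) → Admissible n m A →
       Σ (Tuple n m) λ p → IsVertex n m p × support p ≈ˢ A)
theorem4p23 (suc n) m _ _ =
    (λ _ → vertex⇒admissible zero)
  , (λ _ _ → vertex-determined-by-support)
  , (λ _ → admissible⇒vertex zero)
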